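{- Let $N\geq 2$ be an integer and let $\{z_1(k)\}_{k=0}^{\infty},\ldots,\{z_N(k)\}_{k=0}^{\infty}$ be sequences of complex numbers. For $k\in\mathbb{N}_0$ put \[ t(k)=\sum_{\substack{i_1,\ldots,i_N\geq 0\\ i_1+\cdots+i_N=k}} z_1(i_1)z_2(i_2)\cdots z_N(i_N). \] (a) Suppose there is $d\in\mathbb{N}$ such that for every $j=1,\ldots,N$, \[ z_j(k)=0 \quad\text{for all } k\in\mathbb{N}_0 \text{ with } \tfrac{d-1}{N}<k<d. \tag{1} \] Then \[ \sum_{k=0}^{d-1} t(k)=\prod_{j=1}^{N}\Big(\sum_{k=0}^{d-1} z_j(k)\Big). \] (b) Suppose $d\in\mathbb{N}$ satisfies (1) for every $j$, and moreover for every $j=1,\ldots,N$, \[ z_j(ld+k)=z_j(ld)\,z_j(k)\quad\text{for all } k,l\in\mathbb{N}_0 \text{ with } 0\leq k<d. \tag{2} \] Then for all $k,l\in\mathbb{N}_0$ with $0\leq k<d$, \[ t(ld+k)=t(k)\sum_{\substack{i_1,\ldots,i_N\geq 0\\ i_1+\cdots+i_N=l}} z_1(i_1d)\,z_2(i_2d)\cdots z_N(i_Nd). \] (c) If $d\in\mathbb{N}$ is such that for all $j=1,\ldots,N$ the sequence $\{z_j(k)\}$ satisfies both (1) and (2), and $n$ is a positive multiple of $d$, then \[ \sum_{k=0}^{n-1}t(k)=\Big(\sum_{l=0}^{\frac{n}{d}-1}\ \sum_{\substack{i_1,\ldots,i_N\geq 0\\ i_1+\cdots+i_N=l}} z_1(i_1d)\cdots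 z_N(i_Nd)\Big)\sum_{k=0}^{d-1}t(k). \]
   Context: $\mathbb{N}$ denotes the positive integers and $\mathbb{N}_0$ the nonnegative integers. -}

module Defs where

open import Level using (Level)
open import Algebra.Bundles using (CommutativeRing)
open import Data.Nat using (ℕ; zero; suc; _∸_; _≤_)
open import Data.Fin using (Fin)
open import Data.List using (List; []; _∷_; map; concatMap; upTo)
open import Data.Vec using (Vec; lookup) renaming ([] to []ᵛ; _∷_ to _∷ᵛ_)

-- All N-tuples (i₁,…,i_N) of nonnegative integers with i₁+⋯+i_N = k,
-- enumerated explicitly (each tuple exactly once).
compositions : (N k : ℕ) → List (Vec ℕ N)
compositions zero zero    = []ᵛ ∷ []
compositions zero (suc k) = []
compositions (suc N) k    =
  concatMap (λ i → map (i ∷ᵛ_) (compositions N (k ∸ i))) (upTo (suc k))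

module _ {c ℓ : Level} (R : CommutativeRing c ℓ) where
  open CommutativeRing R

  sumList : List Carrier → Carrier
  sumList []       = 0#
  sumList (x ∷ xs) = x + sumList xs

  sumTo : ℕ → (ℕ → Carrier) → Carrier
  sumTo zero    f = 0#
  sumTo (suc n) f = sumTo n f + f n

  prodFin : (N : ℕ) → (Fin N → Carrier) → Carrier
  prodFin zero    f = 1#
  prodFin (suc N) f = f Fin.zero * prodFin N (λ j → f (Fin.suc j))

  convSum : (N : ℕ) → (Fin N → ℕ → Carrier) → ℕ → Carrier
  convSum N z k = sumList (map (λ v → prodFin N (λ j → z j (lookup v j))) (compositions N k))

-- Everything follows from one observation: if every zⱼ vanishes strictly between a and d, and
-- N·a < d, then so does the convolution t = z₁ ⋆ ⋯ ⋆ z_N between N·a and d; this is proved by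
-- induction on N, peeling off z₁ via t = z₁ ⋆ (z₂ ⋆ ⋯ ⋆ z_N).  With a = ⌊(d-1)/N⌋ condition (1)
-- is exactly such a gap.
-- (a) In Σ_{k<d} t(k) = Σ_{i<d} z₁(i) Σ_{m<d-i} (z₂ ⋆ ⋯)(m) only i ≤ a contributes, and then the
--     inner sum may be extended to m < d because of the gap; induct on N.
-- (b) Write t(ld+k) = Σ_{l₁ ≤ l} Σ_{k₁ < d} z₁(l₁d+k₁) (z₂ ⋆ ⋯)(ld+k-l₁d-k₁).
--     The terms with k < k₁ vanish (for k₁ > a by the gap of z₁ and (2), for k₁ ≤ a by the gap
--     of z₂ ⋆ ⋯ and induction), and the others factor by (2) and induction into t(k) times the
--     convolution of the zⱼ(·d).
-- (c) Split Σ_{k<md} into m blocks of length d and apply (b) to each block.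
module Submission where

open import Defs
open import Level using (Level)
open import Algebra.Bundles using (CommutativeRing)
open import Data.Nat using (ℕ; zero; suc; _∸_; _≤_; _<_; s≤s; NonZero) renaming (_*_ to _*ℕ_; _+_ to _+ℕ_)
import Data.Nat.Properties as ℕ
open import Data.Nat.DivMod using (_/_; _%_; m/n*n≤m; m≡m%n+[m/n]*n; m%n<n)
open import Data.Fin as Fin using (Fin)
open import Data.Product using (_×_; _,_)
open import Data.List using (List; []; _∷_; [_]; map; concatMap; upTo; _++_; _∷ʳ_)
open import Data.List.Properties using (map-++; map-∘; applyUpTo-∷ʳ)
open import Data.Vec using (Vec; lookup; _∷_)
open import Data.Vec.Functional using (head; tail)
open import Function using (id; _∘_)
open import Relation.Nullary using (yes; no)
open import Relation.Binary.PropositionalEquality as ≡ using (_≡_)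

[m*d+k]∸[n*d+j]≡[m∸n]*d+[k∸j] : ∀ {m n k j} d → n ≤ m → j ≤ k →
  (m *ℕ d +ℕ k) ∸ (n *ℕ d +ℕ j) ≡ (m ∸ n) *ℕ d +ℕ (k ∸ j)
[m*d+k]∸[n*d+j]≡[m∸n]*d+[k∸j] {m} {zero} d _ j≤k = ℕ.+-∸-assoc (m *ℕ d) j≤k
[m*d+k]∸[n*d+j]≡[m∸n]*d+[k∸j] {suc m} {suc n} {k} {j} d (s≤s n≤m) j≤k = begin
  (d +ℕ m *ℕ d +ℕ k) ∸ (d +ℕ n *ℕ d +ℕ j)
    ≡⟨ ≡.cong₂ _∸_ (ℕ.+-assoc d (m *ℕ d) k) (ℕ.+-assoc d (n *ℕ d) j) ⟩
  (d +ℕ (m *ℕ d +ℕ k)) ∸ (d +ℕ (n *ℕ d +ℕ j)) ≡⟨ ℕ.[m+n]∸[m+o]≡n∸o d _ _ ⟩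
  (m *ℕ d +ℕ k) ∸ (n *ℕ d +ℕ j)              ≡⟨ [m*d+k]∸[n*d+j]≡[m∸n]*d+[k∸j] d n≤m j≤k ⟩
  (m ∸ n) *ℕ d +ℕ (k ∸ j)                    ∎
  where open ≡.≡-Reasoning

[m*d+k]∸[n*d+j]≡[m∸1+n]*d+[d+k∸j] : ∀ {m n k j} d → n < m → j ≤ d →
  (m *ℕ d +ℕ k) ∸ (n *ℕ d +ℕ j) ≡ (m ∸ suc n) *ℕ d +ℕ (d +ℕ k ∸ j)
[m*d+k]∸[n*d+j]≡[m∸1+n]*d+[d+k∸j] {suc m} {n} {k} {j} d (s≤s n≤m) j≤d = begin
  (d +ℕ m *ℕ d +ℕ k) ∸ (n *ℕ d +ℕ j)
    ≡⟨ ≡.cong (λ x → (x +ℕ k) ∸ (n *ℕ d +ℕ j)) (ℕ.+-comm d (m *ℕ d)) ⟩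
  (m *ℕ d +ℕ d +ℕ k) ∸ (n *ℕ d +ℕ j)
    ≡⟨ ≡.cong (_∸ (n *ℕ d +ℕ j)) (ℕ.+-assoc (m *ℕ d) d k) ⟩
  (m *ℕ d +ℕ (d +ℕ k)) ∸ (n *ℕ d +ℕ j)
    ≡⟨ [m*d+k]∸[n*d+j]≡[m∸n]*d+[k∸j] d n≤m (ℕ.≤-trans j≤d (ℕ.m≤m+n d k)) ⟩
  (m ∸ n) *ℕ d +ℕ (d +ℕ k ∸ j) ∎
  where open ≡.≡-Reasoning

i≤m∧m+n<o⇒n<o∸i : ∀ {i m n o} → i ≤ m → m +ℕ n < o → n < o ∸ i
i≤m∧m+n<o⇒n<o∸i {i} {m} {n} i≤m m+n<o = ℕ.m+n≤o⇒m≤o∸n (suc n)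
  (ℕ.≤-trans (s≤s (ℕ.≤-trans (ℕ.+-monoʳ-≤ n i≤m) (ℕ.≤-reflexive (ℕ.+-comm n m)))) m+n<o)

m/n<k⇒m<n*k : ∀ m n .{{_ : NonZero n}} {k} → m / n < k → m < n *ℕ k
m/n<k⇒m<n*k m n {k} m/n<k = begin-strict
  m                     ≡⟨ m≡m%n+[m/n]*n m n ⟩
  m % n +ℕ m / n *ℕ n   <⟨ ℕ.+-monoˡ-< (m / n *ℕ n) (m%n<n m n) ⟩
  suc (m / n) *ℕ n      ≤⟨ ℕ.*-monoˡ-≤ n m/n<k ⟩
  k *ℕ n                ≡⟨ ℕ.*-comm k n ⟩
  n *ℕ k                ∎
  where open ℕ.≤-Reasoning

module _ {c ℓ : Level} (R : CommutativeRing c ℓ) where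
  open CommutativeRing R
  open import Algebra.Properties.CommutativeSemigroup *-commutativeSemigroup
    using () renaming (interchange to *-interchange)
  open import Algebra.Properties.CommutativeSemigroup +-commutativeSemigroup
    using () renaming (interchange to +-interchange)
  open import Relation.Binary.Reasoning.Setoid setoid

  ∑ : ℕ → (ℕ → Carrier) → Carrier
  ∑ = sumTo R

  ∑≤ : ℕ → (ℕ → Carrier) → Carrier
  ∑≤ n = ∑ (suc n)

  syntax ∑ n (λ i → x) = ∑[ i < n ] x
  syntax ∑≤ n (λ i → x) = ∑[ i ≤ n ] x

  conv : (N : ℕ) → (Fin N → ℕ → Carrier) → ℕ → Carrier
  conv = convSum R

  subsample : ℕ → (ℕ → Carrier) → ℕ → Carrier
  subsample d f i = f (i *ℕ d)

  ZeroBetween : ℕ → ℕ → (ℕ → Carrier) → Set ℓ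
  ZeroBetween a d f = ∀ k → a < k → k < d → f k ≈ 0#

  BlockMultiplicative : ℕ → (ℕ → Carrier) → Set ℓ
  BlockMultiplicative d f = ∀ k l → k < d → f (l *ℕ d +ℕ k) ≈ f (l *ℕ d) * f k

  ∑-cong : ∀ n {f g : ℕ → Carrier} → (∀ i → i < n → f i ≈ g i) → ∑ n f ≈ ∑ n g
  ∑-cong zero    f≈g = refl
  ∑-cong (suc n) f≈g = +-cong (∑-cong n (λ i i<n → f≈g i (ℕ.m<n⇒m<1+n i<n))) (f≈g n ℕ.≤-refl)

  ∑-vanishing : ∀ n {f : ℕ → Carrier} → (∀ i → i < n → f i ≈ 0#) → ∑ n f ≈ 0#
  ∑-vanishing n f≈0 = trans (∑-cong n f≈0) (zeros n)
    where
    zeros : ∀ n → ∑[ i < n ] 0# ≈ 0#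
    zeros zero    = refl
    zeros (suc n) = trans (+-identityʳ _) (zeros n)

  ∑-distrib-+ : ∀ n (f g : ℕ → Carrier) → ∑[ i < n ] (f i + g i) ≈ ∑ n f + ∑ n g
  ∑-distrib-+ zero    f g = sym (+-identityˡ 0#)
  ∑-distrib-+ (suc n) f g = trans (+-congʳ (∑-distrib-+ n f g)) (+-interchange _ _ _ _)

  *-distribˡ-∑ : ∀ n x (f : ℕ → Carrier) → x * ∑ n f ≈ ∑[ i < n ] (x * f i)
  *-distribˡ-∑ zero    x f = zeroʳ x
  *-distribˡ-∑ (suc n) x f = trans (distribˡ x _ _) (+-congʳ (*-distribˡ-∑ n x f))

  *-distribʳ-∑ : ∀ n x (f : ℕ → Carrier) → ∑ n f * x ≈ ∑[ i < n ] (f i * x)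
  *-distribʳ-∑ zero    x f = zeroˡ x
  *-distribʳ-∑ (suc n) x f = trans (distribʳ x _ _) (+-congʳ (*-distribʳ-∑ n x f))

  ∑-+ : ∀ m n (f : ℕ → Carrier) → ∑ (m +ℕ n) f ≈ ∑ m f + ∑[ i < n ] f (m +ℕ i)
  ∑-+ m zero f rewrite ℕ.+-identityʳ m = sym (+-identityʳ _)
  ∑-+ m (suc n) f rewrite ℕ.+-suc m n =
    trans (+-congʳ (∑-+ m n f)) (+-assoc _ _ _)

  ∑-* : ∀ l d (f : ℕ → Carrier) → ∑ (l *ℕ d) f ≈ ∑[ l₁ < l ] ∑[ k < d ] f (l₁ *ℕ d +ℕ k)
  ∑-* zero    d f = refl
  ∑-* (suc l) d f = begin
    ∑ (d +ℕ l *ℕ d) f                                   ≡⟨ ≡.cong (λ n → ∑ n f) (ℕ.+-comm d (l *ℕ d)) ⟩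
    ∑ (l *ℕ d +ℕ d) f                                   ≈⟨ ∑-+ (l *ℕ d) d f ⟩
    ∑ (l *ℕ d) f + ∑[ k < d ] f (l *ℕ d +ℕ k)            ≈⟨ +-congʳ (∑-* l d f) ⟩
    ∑[ l₁ < suc l ] ∑[ k < d ] f (l₁ *ℕ d +ℕ k)         ∎

  ∑-truncate : ∀ {b n m} {f : ℕ → Carrier} → b < n → n ≤ m → ZeroBetween b m f → ∑ m f ≈ ∑ n f
  ∑-truncate {n = n} {m} {f} b<n n≤m f≈0 = begin
    ∑ m f                                   ≡⟨ ≡.cong (λ k → ∑ k f) (ℕ.m+[n∸m]≡n n≤m) ⟨
    ∑ (n +ℕ (m ∸ n)) f                      ≈⟨ ∑-+ n (m ∸ n) f ⟩
    ∑ n f + ∑[ i < m ∸ n ] f (n +ℕ i)       ≈⟨ +-congˡ (∑-vanishing (m ∸ n) tail≈0) ⟩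
    ∑ n f + 0#                              ≈⟨ +-identityʳ _ ⟩
    ∑ n f                                   ∎
    where
    tail≈0 : ∀ i → i < m ∸ n → f (n +ℕ i) ≈ 0#
    tail≈0 i i<m∸n = f≈0 (n +ℕ i) (ℕ.<-≤-trans b<n (ℕ.m≤m+n n i))
      (≡.subst (n +ℕ i <_) (ℕ.m+[n∸m]≡n n≤m) (ℕ.+-monoʳ-< n i<m∸n))

  ∑-triangle : ∀ d (f : ℕ → ℕ → Carrier) →
    ∑[ k < d ] ∑[ i ≤ k ] f i (k ∸ i) ≈ ∑[ i < d ] ∑[ m < d ∸ i ] f i m
  ∑-triangle zero    f = refl
  ∑-triangle (suc d) f = begin
    ∑[ k < d ] ∑[ i ≤ k ] f i (k ∸ i) + ∑[ i ≤ d ] f i (d ∸ i)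
      ≈⟨ +-congʳ (∑-triangle d f) ⟩
    ∑[ i < d ] ∑ (d ∸ i) (f i) + ∑[ i ≤ d ] f i (d ∸ i)
      ≈⟨ +-congʳ (+-identityʳ _) ⟨
    (∑[ i < d ] ∑ (d ∸ i) (f i) + 0#) + ∑[ i ≤ d ] f i (d ∸ i)
      ≡⟨ ≡.cong (λ n → (∑[ i < d ] ∑ (d ∸ i) (f i) + ∑ n (f d)) + ∑[ i ≤ d ] f i (d ∸ i)) (ℕ.n∸n≡0 d) ⟨
    ∑[ i ≤ d ] ∑ (d ∸ i) (f i) + ∑[ i ≤ d ] f i (d ∸ i)
      ≈⟨ ∑-distrib-+ (suc d) _ _ ⟨
    ∑[ i ≤ d ] (∑ (d ∸ i) (f i) + f i (d ∸ i))
      ≈⟨ ∑-cong (suc d) (λ i i≤d → reflexive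
           (≡.cong (λ n → ∑ n (f i)) (≡.sym (ℕ.+-∸-assoc 1 (ℕ.≤-pred i≤d))))) ⟩
    ∑[ i ≤ d ] ∑ (suc d ∸ i) (f i) ∎

  *-congˡ-onSupport : ∀ {a d i x y} {f : ℕ → Carrier} → ZeroBetween a d f → i < d →
    (i ≤ a → x ≈ y) → f i * x ≈ f i * y
  *-congˡ-onSupport {a} {i = i} {x} {y} {f} f≈0 i<d x≈y with i ℕ.≤? a
  ... | yes i≤a = *-congˡ (x≈y i≤a)
  ... | no  i≰a = begin
    f i * x ≈⟨ *-congʳ fi≈0 ⟩
    0# * x  ≈⟨ zeroˡ x ⟩
    0#      ≈⟨ zeroˡ y ⟨
    0# * y  ≈⟨ *-congʳ fi≈0 ⟨
    f i * y ∎
    where fi≈0 = f≈0 i (ℕ.≰⇒> i≰a) i<d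

  sumList-++ : ∀ xs ys → sumList R (xs ++ ys) ≈ sumList R xs + sumList R ys
  sumList-++ []       ys = sym (+-identityˡ _)
  sumList-++ (x ∷ xs) ys = trans (+-congˡ (sumList-++ xs ys)) (sym (+-assoc _ _ _))

  sumList-concatMap : ∀ {A B : Set} (g : B → Carrier) (h : A → List B) xs →
    sumList R (map g (concatMap h xs)) ≈ sumList R (map (sumList R ∘ map g ∘ h) xs)
  sumList-concatMap g h []       = refl
  sumList-concatMap g h (x ∷ xs) = begin
    sumList R (map g (h x ++ concatMap h xs))           ≡⟨ ≡.cong (sumList R) (map-++ g (h x) _) ⟩
    sumList R (map g (h x) ++ map g (concatMap h xs))   ≈⟨ sumList-++ (map g (h x)) _ ⟩
    sumList R (map g (h x)) + sumList R (map g (concatMap h xs))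
      ≈⟨ +-congˡ (sumList-concatMap g h xs) ⟩
    sumList R (map (sumList R ∘ map g ∘ h) (x ∷ xs))    ∎

  *-distribˡ-sumList : ∀ {A : Set} x (f : A → Carrier) xs →
    x * sumList R (map f xs) ≈ sumList R (map (λ a → x * f a) xs)
  *-distribˡ-sumList x f []       = zeroʳ x
  *-distribˡ-sumList x f (a ∷ xs) = trans (distribˡ x _ _) (+-congˡ (*-distribˡ-sumList x f xs))

  sumList-upTo : ∀ n (g : ℕ → Carrier) → sumList R (map g (upTo n)) ≈ ∑ n g
  sumList-upTo zero    g = refl
  sumList-upTo (suc n) g = begin
    sumList R (map g (upTo (suc n)))       ≡⟨ ≡.cong (sumList R ∘ map g) (applyUpTo-∷ʳ id n) ⟨
    sumList R (map g (upTo n ∷ʳ n))        ≡⟨ ≡.cong (sumList R) (map-++ g (upTo n) [ n ]) ⟩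
    sumList R (map g (upTo n) ++ [ g n ])  ≈⟨ sumList-++ (map g (upTo n)) [ g n ] ⟩
    sumList R (map g (upTo n)) + (g n + 0#) ≈⟨ +-cong (sumList-upTo n g) (+-identityʳ (g n)) ⟩
    ∑ (suc n) g                            ∎

  convSum-suc : ∀ N (z : Fin (suc N) → ℕ → Carrier) k →
    conv (suc N) z k ≈ ∑[ i ≤ k ] (head z i * conv N (tail z) (k ∸ i))
  convSum-suc N z k = begin
    sumList R (map g (concatMap h (upTo (suc k))))           ≈⟨ sumList-concatMap g h (upTo (suc k)) ⟩
    sumList R (map (sumList R ∘ map g ∘ h) (upTo (suc k)))   ≈⟨ sumList-upTo (suc k) _ ⟩
    ∑[ i ≤ k ] sumList R (map g (h i))                       ≈⟨ ∑-cong (suc k) (λ i _ → row i) ⟩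
    ∑[ i ≤ k ] (head z i * conv N (tail z) (k ∸ i))          ∎
    where
    g : Vec ℕ (suc N) → Carrier
    g v = prodFin R (suc N) (λ j → z j (lookup v j))
    h : ℕ → List (Vec ℕ (suc N))
    h i = map (i ∷_) (compositions N (k ∸ i))
    row : ∀ i → sumList R (map g (h i)) ≈ head z i * conv N (tail z) (k ∸ i)
    row i = begin
      sumList R (map g (map (i ∷_) (compositions N (k ∸ i))))
        ≡⟨ ≡.cong (sumList R) (map-∘ (compositions N (k ∸ i))) ⟨
      sumList R (map (λ v → head z i * prodFin R N (λ j → tail z j (lookup v j))) (compositions N (k ∸ i)))
        ≈⟨ *-distribˡ-sumList (head z i) _ (compositions N (k ∸ i)) ⟨
      head z i * conv N (tail z) (k ∸ i) ∎

  convSum-zeroBetween : ∀ N {a d} (z : Fin N → ℕ → Carrier) → (∀ j → ZeroBetween a d (z j)) →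
    ZeroBetween (N *ℕ a) d (conv N z)
  convSum-zeroBetween zero    z gap (suc m) _ _ = refl
  convSum-zeroBetween (suc N) {a} z gap m a+Na<m m<d = begin
    conv (suc N) z m                                  ≈⟨ convSum-suc N z m ⟩
    ∑[ i ≤ m ] (head z i * conv N (tail z) (m ∸ i))   ≈⟨ ∑-vanishing (suc m) term≈0 ⟩
    0#                                                ∎
    where
    term≈0 : ∀ i → i < suc m → head z i * conv N (tail z) (m ∸ i) ≈ 0#
    term≈0 i i<1+m = trans (*-congˡ-onSupport (gap Fin.zero) (ℕ.<-≤-trans i<1+m m<d) tail≈0) (zeroʳ _)
      where
      tail≈0 : i ≤ a → conv N (tail z) (m ∸ i) ≈ 0#
      tail≈0 i≤a = convSum-zeroBetween N (tail z) (gap ∘ Fin.suc) (m ∸ i)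
        (i≤m∧m+n<o⇒n<o∸i i≤a a+Na<m) (ℕ.≤-<-trans (ℕ.m∸n≤m m i) m<d)

  ∑-convSum : ∀ N {a d} (z : Fin N → ℕ → Carrier) → N *ℕ a < d → (∀ j → ZeroBetween a d (z j)) →
    ∑ d (conv N z) ≈ prodFin R N (λ j → ∑ d (z j))
  ∑-convSum zero {d = d} z 0<d gap = begin
    ∑ d (conv 0 z) ≈⟨ ∑-truncate (ℕ.n<1+n 0) 0<d (convSum-zeroBetween 0 z gap) ⟩
    0# + (1# + 0#) ≈⟨ +-identityˡ _ ⟩
    1# + 0#        ≈⟨ +-identityʳ 1# ⟩
    1#             ∎
  ∑-convSum (suc N) {a} {d} z a+Na<d gap = begin
    ∑[ k < d ] conv (suc N) z k
      ≈⟨ ∑-cong d (λ k _ → convSum-suc N z k) ⟩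
    ∑[ k < d ] ∑[ i ≤ k ] (head z i * C′ (k ∸ i))
      ≈⟨ ∑-triangle d (λ i m → head z i * C′ m) ⟩
    ∑[ i < d ] ∑[ m < d ∸ i ] (head z i * C′ m)
      ≈⟨ ∑-cong d (λ i _ → *-distribˡ-∑ (d ∸ i) (head z i) C′) ⟨
    ∑[ i < d ] (head z i * ∑ (d ∸ i) C′)
      ≈⟨ ∑-cong d (λ i i<d → *-congˡ-onSupport (gap Fin.zero) i<d (inner i)) ⟩
    ∑[ i < d ] (head z i * Π′)
      ≈⟨ *-distribʳ-∑ d Π′ (head z) ⟨
    ∑ d (head z) * Π′ ∎
    where
    C′ = conv N (tail z)
    Π′ = prodFin R N (λ j → ∑ d (tail z j))
    Na<d = ℕ.≤-<-trans (ℕ.m≤n+m (N *ℕ a) a) a+Na<d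
    inner : ∀ i → i ≤ a → ∑ (d ∸ i) C′ ≈ Π′
    inner i i≤a = begin
      ∑ (d ∸ i) C′ ≈⟨ ∑-truncate (i≤m∧m+n<o⇒n<o∸i i≤a a+Na<d) (ℕ.m∸n≤m d i)
                        (convSum-zeroBetween N (tail z) (gap ∘ Fin.suc)) ⟨
      ∑ d C′       ≈⟨ ∑-convSum N (tail z) Na<d (gap ∘ Fin.suc) ⟩
      Π′           ∎

  convSum-blocks : ∀ N {a d} (z : Fin N → ℕ → Carrier) → N *ℕ a < d →
    (∀ j → ZeroBetween a d (z j)) → (∀ j → BlockMultiplicative d (z j)) →
    ∀ k l → k < d → conv N z (l *ℕ d +ℕ k) ≈ conv N z k * conv N (λ j → subsample d (z j)) l
  convSum-blocks zero {d = suc _} z _ _ _ zero    zero    _ = sym (trans (*-congˡ (+-identityʳ 1#)) (*-identityʳ _))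
  convSum-blocks zero {d = suc _} z _ _ _ (suc k) zero    _ = sym (zeroˡ _)
  convSum-blocks zero {d = suc _} z _ _ _ k       (suc l) _ = sym (zeroʳ _)
  convSum-blocks (suc N) {a} {d} z a+Na<d gap mult k l k<d = begin
    conv (suc N) z (l *ℕ d +ℕ k)               ≈⟨ convSum-suc N z _ ⟩
    ∑[ i ≤ l *ℕ d +ℕ k ] F i                   ≡⟨ ≡.cong (λ n → ∑ n F) (ℕ.+-suc (l *ℕ d) k) ⟨
    ∑ (l *ℕ d +ℕ suc k) F                      ≈⟨ ∑-+ (l *ℕ d) (suc k) F ⟩
    ∑ (l *ℕ d) F + ∑[ k₁ ≤ k ] F (l *ℕ d +ℕ k₁) ≈⟨ +-congʳ (∑-* l d F) ⟩
    ∑[ l₁ < l ] ∑[ k₁ < d ] F (l₁ *ℕ d +ℕ k₁) + ∑[ k₁ ≤ k ] F (l *ℕ d +ℕ k₁)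
      ≈⟨ +-cong (∑-cong l (λ l₁ l₁<l → trans (∑-truncate (ℕ.n<1+n k) k<d (block-tail≈0 l₁ l₁<l))
                                              (block l₁ (ℕ.<⇒≤ l₁<l))))
                (block l ℕ.≤-refl) ⟩
    ∑[ l₁ < l ] (P * G l₁) + P * G l           ≈⟨ +-congʳ (*-distribˡ-∑ l P G) ⟨
    P * ∑ l G + P * G l                        ≈⟨ distribˡ P _ _ ⟨
    P * ∑[ l₁ ≤ l ] G l₁                       ≈⟨ *-cong (convSum-suc N z k) (convSum-suc N zd l) ⟨
    conv (suc N) z k * conv (suc N) zd l       ∎
    where
    C′  = conv N (tail z)
    zd  = λ j → subsample d (z j)
    C′d = conv N (tail zd)
    F : ℕ → Carrier
    F i = head z i * C′ (l *ℕ d +ℕ k ∸ i)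
    P = ∑[ k₁ ≤ k ] (head z k₁ * C′ (k ∸ k₁))
    G : ℕ → Carrier
    G l₁ = head z (l₁ *ℕ d) * C′d (l ∸ l₁)
    Na<d = ℕ.≤-<-trans (ℕ.m≤n+m (N *ℕ a) a) a+Na<d
    C′-blocks = convSum-blocks N (tail z) Na<d (gap ∘ Fin.suc) (mult ∘ Fin.suc)

    block : ∀ l₁ → l₁ ≤ l → ∑[ k₁ ≤ k ] F (l₁ *ℕ d +ℕ k₁) ≈ P * G l₁
    block l₁ l₁≤l = trans (∑-cong (suc k) (λ k₁ k₁<1+k → term k₁ (ℕ.≤-pred k₁<1+k)))
                          (sym (*-distribʳ-∑ (suc k) (G l₁) _))
      where
      term : ∀ k₁ → k₁ ≤ k → F (l₁ *ℕ d +ℕ k₁) ≈ (head z k₁ * C′ (k ∸ k₁)) * G l₁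
      term k₁ k₁≤k = begin
        head z (l₁ *ℕ d +ℕ k₁) * C′ (l *ℕ d +ℕ k ∸ (l₁ *ℕ d +ℕ k₁))
          ≡⟨ ≡.cong (λ n → head z (l₁ *ℕ d +ℕ k₁) * C′ n)
                    ([m*d+k]∸[n*d+j]≡[m∸n]*d+[k∸j] d l₁≤l k₁≤k) ⟩
        head z (l₁ *ℕ d +ℕ k₁) * C′ ((l ∸ l₁) *ℕ d +ℕ (k ∸ k₁))
          ≈⟨ *-cong (mult Fin.zero k₁ l₁ (ℕ.≤-<-trans k₁≤k k<d))
                    (C′-blocks (k ∸ k₁) (l ∸ l₁) (ℕ.≤-<-trans (ℕ.m∸n≤m k k₁) k<d)) ⟩
        (head z (l₁ *ℕ d) * head z k₁) * (C′ (k ∸ k₁) * C′d (l ∸ l₁))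
          ≈⟨ *-congʳ (*-comm _ _) ⟩
        (head z k₁ * head z (l₁ *ℕ d)) * (C′ (k ∸ k₁) * C′d (l ∸ l₁))
          ≈⟨ *-interchange _ _ _ _ ⟩
        (head z k₁ * C′ (k ∸ k₁)) * G l₁ ∎

    block-tail≈0 : ∀ l₁ → l₁ < l → ZeroBetween k d (λ k₁ → F (l₁ *ℕ d +ℕ k₁))
    block-tail≈0 l₁ l₁<l k₁ k<k₁ k₁<d = begin
      head z (l₁ *ℕ d +ℕ k₁) * C′ (l *ℕ d +ℕ k ∸ (l₁ *ℕ d +ℕ k₁))
        ≈⟨ *-congʳ (mult Fin.zero k₁ l₁ k₁<d) ⟩
      (head z (l₁ *ℕ d) * head z k₁) * C′ (l *ℕ d +ℕ k ∸ (l₁ *ℕ d +ℕ k₁))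
        ≈⟨ *-assoc _ _ _ ⟩
      head z (l₁ *ℕ d) * (head z k₁ * C′ (l *ℕ d +ℕ k ∸ (l₁ *ℕ d +ℕ k₁)))
        ≈⟨ *-congˡ (*-congˡ-onSupport (gap Fin.zero) k₁<d C′≈0) ⟩
      head z (l₁ *ℕ d) * (head z k₁ * 0#) ≈⟨ *-congˡ (zeroʳ _) ⟩
      head z (l₁ *ℕ d) * 0#                ≈⟨ zeroʳ _ ⟩
      0#                                   ∎
      where
      r = d +ℕ k ∸ k₁
      r<d : r < d
      r<d = ≡.subst (r <_) (ℕ.m+n∸n≡m d k₁)
        (ℕ.∸-monoˡ-< (ℕ.+-monoʳ-< d k<k₁) (ℕ.≤-trans (ℕ.<⇒≤ k₁<d) (ℕ.m≤m+n d k)))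
      C′≈0 : k₁ ≤ a → C′ (l *ℕ d +ℕ k ∸ (l₁ *ℕ d +ℕ k₁)) ≈ 0#
      C′≈0 k₁≤a = begin
        C′ (l *ℕ d +ℕ k ∸ (l₁ *ℕ d +ℕ k₁))
          ≡⟨ ≡.cong C′ ([m*d+k]∸[n*d+j]≡[m∸1+n]*d+[d+k∸j] d l₁<l (ℕ.<⇒≤ k₁<d)) ⟩
        C′ ((l ∸ suc l₁) *ℕ d +ℕ r) ≈⟨ C′-blocks r (l ∸ suc l₁) r<d ⟩
        C′ r * C′d (l ∸ suc l₁)     ≈⟨ *-congʳ (convSum-zeroBetween N (tail z) (gap ∘ Fin.suc) r Na<r r<d) ⟩
        0# * C′d (l ∸ suc l₁)       ≈⟨ zeroˡ _ ⟩
        0#                          ∎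
        where
        Na<r = ℕ.<-≤-trans (i≤m∧m+n<o⇒n<o∸i k₁≤a a+Na<d) (ℕ.∸-monoˡ-≤ k₁ (ℕ.m≤m+n d k))

  ∑-convSum-blocks : ∀ N {a d} (z : Fin N → ℕ → Carrier) → N *ℕ a < d →
    (∀ j → ZeroBetween a d (z j)) → (∀ j → BlockMultiplicative d (z j)) →
    ∀ m → ∑ (m *ℕ d) (conv N z) ≈ ∑ m (conv N (λ j → subsample d (z j))) * ∑ d (conv N z)
  ∑-convSum-blocks N {d = d} z Na<d gap mult m = begin
    ∑ (m *ℕ d) C                              ≈⟨ ∑-* m d C ⟩
    ∑[ l < m ] ∑[ k < d ] C (l *ℕ d +ℕ k)     ≈⟨ ∑-cong m (λ l _ → ∑-cong d (λ k k<d →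
                                                    convSum-blocks N z Na<d gap mult k l k<d)) ⟩
    ∑[ l < m ] ∑[ k < d ] (C k * Cd l)        ≈⟨ ∑-cong m (λ l _ → *-distribʳ-∑ d (Cd l) C) ⟨
    ∑[ l < m ] (∑ d C * Cd l)                 ≈⟨ *-distribˡ-∑ m (∑ d C) Cd ⟨
    ∑ d C * ∑ m Cd                            ≈⟨ *-comm _ _ ⟩
    ∑ m Cd * ∑ d C                            ∎
    where
    C  = conv N z
    Cd = conv N (λ j → subsample d (z j))

lemma1 : ∀ {c ℓ} (R : CommutativeRing c ℓ) → let open CommutativeRing R in
    (N : ℕ) → 2 ≤ N → (z : Fin N → ℕ → Carrier) → (d : ℕ) → 1 ≤ d →
    -- condition (1):  (d-1)/N < k < d  ⇒  z_j(k) = 0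
    (∀ (j : Fin N) (k : ℕ) → d ∸ 1 < N *ℕ k → k < d → z j k ≈ 0#) →
    -- (a)
    (sumTo R d (convSum R N z) ≈ prodFin R N (λ j → sumTo R d (z j)))
    ×
    -- condition (2):  z_j(ld+k) = z_j(ld) z_j(k) for 0 ≤ k < d
    ((∀ (j : Fin N) (k l : ℕ) → k < d → z j (l *ℕ d +ℕ k) ≈ z j (l *ℕ d) * z j k) →
      -- (b)
      (∀ (k l : ℕ) → k < d →
        convSum R N z (l *ℕ d +ℕ k) ≈ convSum R N z k * convSum R N (λ j i → z j (i *ℕ d)) l)
      ×
      -- (c)  n = m d a positive multiple of d, so n/d = m
      (∀ (m : ℕ) → 1 ≤ m →
        sumTo R (m *ℕ d) (convSum R N z)
          ≈ sumTo R m (convSum R N (λ j i → z j (i *ℕ d))) * sumTo R d (convSum R N z)))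
lemma1 R N@(suc _) (s≤s _) z d@(suc d′) (s≤s _) condition₁ =
  ∑-convSum R N z Na<d gap ,
  λ condition₂ → convSum-blocks R N z Na<d gap condition₂ ,
                 λ m _ → ∑-convSum-blocks R N z Na<d gap condition₂ m
  where
  a = d′ / N
  Na<d : N *ℕ a < d
  Na<d = s≤s (ℕ.≤-trans (ℕ.≤-reflexive (ℕ.*-comm N a)) (m/n*n≤m d′ N))
  gap : ∀ j → ZeroBetween R a d (z j)
  gap j k a<k = condition₁ j k (m/n<k⇒m<n*k d′ N a<k)
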